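{- For an integer $n \ge 1$, let $S_n$ be the set of polynomials $f \in \mathbb{F}_2[x]$ of degree exactly $n$ with nonzero constant term, and let $A_n = \{(f,g) \in S_n^2 : \gcd(f,g) = 1\}$ be the set of ordered pairs of coprime polynomials in $S_n$. Then $$|A_n| = \sum_{k=2}^{n} 2^{n-k}\binom{n-1}{k-1}\frac{2^k + 2\cdot(-1)^k}{3} = 2\cdot\frac{4^{n-1}-1}{3}.$$
   Context: Pairs are ordered, so $(f,g)$ and $(g,f)$ are counted separately when $f \neq g$. -}

module Defs where

open import Data.Bool using (Bool; true; false; if_then_else_; _xor_)
open import Data.Nat using (ℕ; zero; suc; _+_; _∸_; _≤ᵇ_)
open import Data.List using (List; []; _∷_; _++_; length; replicate; map; concatMap; filter; cartesianProduct; head; last)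
open import Data.Maybe using (Maybe; just)
open import Data.Product using (_×_; _,_)
open import Relation.Binary.PropositionalEquality using (_≡_)
open import Relation.Nullary using (Dec)
open import Relation.Nullary.Decidable using (_×-dec_)
import Data.Bool.Properties as BoolP
import Data.List.Properties as ListP
import Data.Maybe.Properties as MaybeP

-- Polynomials over 𝔽₂ = Bool (with xor as addition), as coefficient lists,
-- lowest degree first: (a₀ ∷ a₁ ∷ … ∷ aₙ ∷ []) stands for a₀ + a₁x + … + aₙxⁿ.
Poly : Set
Poly = List Bool

_⊕_ : Poly → Poly → Poly
[]      ⊕ q       = q
(a ∷ p) ⊕ []      = a ∷ p
(a ∷ p) ⊕ (b ∷ q) = (a xor b) ∷ (p ⊕ q)

-- remove trailing zero coefficients (normal form; the zero polynomial is [])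
private
  cons : Bool → Poly → Poly
  cons a [] = if a then a ∷ [] else []
  cons a (b ∷ q) = a ∷ b ∷ q

norm : Poly → Poly
norm [] = []
norm (a ∷ p) = cons a (norm p)

shift : ℕ → Poly → Poly
shift k p = replicate k false ++ p

-- remainder of long division of f by a normalised nonzero g, with fuel
modF : ℕ → Poly → Poly → Poly
modF zero    f g = f
modF (suc k) f g =
  if length g ≤ᵇ length f
  then modF k (norm (f ⊕ shift (length f ∸ length g) g)) g
  else f

_mod_ : Poly → Poly → Poly
f mod g = modF (length f) f g

-- Euclid's algorithm, with fuel (each step strictly shortens the second argument)
gcdF : ℕ → Poly → Poly → Poly
gcdF zero    f g       = f
gcdF (suc k) f []      = f
gcdF (suc k) f (b ∷ g) = gcdF k (b ∷ g) (f mod (b ∷ g))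

-- gcd in 𝔽₂[x] (monic automatically, since the only unit is 1)
gcd : Poly → Poly → Poly
gcd f g = gcdF (suc (length f + length g)) (norm f) (norm g)

one : Poly
one = true ∷ []

_≟P_ : (p q : Poly) → Dec (p ≡ q)
_≟P_ = ListP.≡-dec BoolP._≟_

allLists : ℕ → List Poly
allLists zero    = [] ∷ []
allLists (suc m) = concatMap (λ b → map (b ∷_) (allLists m)) (true ∷ false ∷ [])

IsS : Poly → Set
IsS f = (head f ≡ just true) × (last f ≡ just true)

isS? : (f : Poly) → Dec (IsS f)
isS? f = MaybeP.≡-dec BoolP._≟_ (head f) (just true) ×-dec MaybeP.≡-dec BoolP._≟_ (last f) (just true)

S : ℕ → List Poly
S n = filter isS? (allLists (suc n))

Coprime : Poly × Poly → Set
Coprime (f , g) = gcd f g ≡ one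

coprime? : (p : Poly × Poly) → Dec (Coprime p)
coprime? (f , g) = gcd f g ≟P one

A : ℕ → List (Poly × Poly)
A n = filter coprime? (cartesianProduct (S n) (S n))

-- Count coprime pairs by one step of Euclid's algorithm. For a monic divisor r of degree
-- d + 1 and f running over the polynomials of degree D > d with f(0) = b, the remainder
-- f mod r runs over the polynomials of degree ≤ d with constant term b or b + r(0), each
-- exactly 2^(D - d - 1) times: cancelling the top coefficient of f translates the lower ones.
-- This gives a linear recursion for the number c_K(b, a) of coprime pairs (f, g) with
-- deg f = K + 1, f(0) = b, deg g ≤ K, g(0) = a, solved by 0, 2(4^K - 1)/3 or
-- 2(4^K - 1)/3 + 1 according as (b, a) = (0, 0), (1, 0) or a = 1. For f, g ∈ S_n the
-- first step is f mod g = f + g, so |A_n| = c_(n-1)(1, 0).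
-- For the binomial form, B_m(u) = Σ_j 2^(m-j) C(m,j) u_j obeys Pascal's rule
-- B_(m+1)(u) = 2 B_m(u) + B_m(u ∘ suc). The summand (2^k + 2(-1)^k)/3 is 2 J_(k-1) for the
-- Jacobsthal numbers J, so the sum is 2 B_(n-1)(J); as J_(j+1) + J_j = 2^j and
-- B_m(2^j) = 4^m, Pascal's rule gives B_m(J) = (4^m - 1)/3.
module Submission where

module Euclid where

  open import Defs
  open import Data.Bool using (true; false; _xor_)
  open import Data.Bool.Properties using (xor-identityʳ)
  open import Data.Nat using (ℕ; zero; suc; _+_; _∸_; _≤ᵇ_; _≤_; _<_; s≤s; z≤n)
  import Data.Nat.Properties as ℕₚ
  open import Data.List using (List; []; _∷_; _++_; _∷ʳ_; [_]; length; replicate)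
  import Data.List.Properties as Listₚ
  open import Data.Product using (_×_; _,_; ∃; proj₁; proj₂)
  open import Data.Sum using (_⊎_; inj₁; inj₂)
  open import Data.Empty using (⊥-elim)
  open import Relation.Binary.PropositionalEquality hiding ([_])
  open import Relation.Nullary.Reflects using (ofʸ; ofⁿ)

  Normal : Poly → Set
  Normal p = norm p ≡ p

  norm-normal : ∀ p → Normal (norm p)
  norm-normal [] = refl
  norm-normal (a ∷ p) with norm p | norm-normal p
  ... | []    | _  with a
  ...   | true  = refl
  ...   | false = refl
  norm-normal (a ∷ p) | b ∷ q | ih rewrite ih = refl

  norm-∷ʳ-false : ∀ p → norm (p ∷ʳ false) ≡ norm p
  norm-∷ʳ-false [] = refl
  norm-∷ʳ-false (a ∷ p) rewrite norm-∷ʳ-false p = refl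

  norm-∷ʳ-true : ∀ p → Normal (p ∷ʳ true)
  norm-∷ʳ-true [] = refl
  norm-∷ʳ-true (a ∷ []) = refl
  norm-∷ʳ-true (a ∷ b ∷ p) rewrite norm-∷ʳ-true (b ∷ p) = refl

  length-norm : ∀ p → length (norm p) ≤ length p
  length-norm [] = z≤n
  length-norm (a ∷ p) with norm p | length-norm p
  ... | []    | _ with a
  ...   | true  = s≤s z≤n
  ...   | false = z≤n
  length-norm (a ∷ p) | b ∷ q | h = s≤s h

  length-∷ʳ : ∀ (p : Poly) c → length (p ∷ʳ c) ≡ suc (length p)
  length-∷ʳ [] c = refl
  length-∷ʳ (_ ∷ p) c = cong suc (length-∷ʳ p c)

  0<length-∷ʳ : ∀ (g : Poly) c → 0 < length (g ∷ʳ c)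
  0<length-∷ʳ g c = subst (0 <_) (sym (length-∷ʳ g c)) (s≤s z≤n)

  Normal⇒≡[]⊎monic : ∀ g → Normal g → g ≡ [] ⊎ ∃ λ g′ → g ≡ g′ ∷ʳ true
  Normal⇒≡[]⊎monic [] _ = inj₁ refl
  Normal⇒≡[]⊎monic (a ∷ p) n with norm p | Normal⇒≡[]⊎monic p
  Normal⇒≡[]⊎monic (true ∷ p) refl | [] | _ = inj₂ ([] , refl)
  Normal⇒≡[]⊎monic (a ∷ p) refl | b ∷ q | rec with rec refl
  ... | inj₁ ()
  ... | inj₂ (g′ , e) = inj₂ (a ∷ g′ , cong (a ∷_) e)

  ⊕-∷ʳ : ∀ x y a b → length x ≡ length y → (x ∷ʳ a) ⊕ (y ∷ʳ b) ≡ (x ⊕ y) ∷ʳ (a xor b)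
  ⊕-∷ʳ [] [] a b _ = refl
  ⊕-∷ʳ (x ∷ xs) (y ∷ ys) a b e = cong ((x xor y) ∷_) (⊕-∷ʳ xs ys a b (ℕₚ.suc-injective e))

  length-⊕ : ∀ x y → length y ≤ length x → length (x ⊕ y) ≡ length x
  length-⊕ [] [] _ = refl
  length-⊕ (x ∷ xs) [] _ = refl
  length-⊕ (x ∷ xs) (y ∷ ys) (s≤s h) = cong suc (length-⊕ xs ys h)

  ⊕-identityʳ : ∀ p → p ⊕ [] ≡ p
  ⊕-identityʳ [] = refl
  ⊕-identityʳ (_ ∷ _) = refl

  shift-∷ʳ : ∀ k g c → shift k (g ∷ʳ c) ≡ shift k g ∷ʳ c
  shift-∷ʳ k g c = sym (Listₚ.++-assoc (replicate k false) g [ c ])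

  length-shift : ∀ k g → length (shift k g) ≡ k + length g
  length-shift k g = trans (Listₚ.length-++ (replicate k false)) (cong (_+ length g) (Listₚ.length-replicate k))

  length-shift-∸ : ∀ (f g : Poly) → length g ≤ length f → length (shift (length f ∸ length g) g) ≡ length f
  length-shift-∸ f g h = trans (length-shift (length f ∸ length g) g) (ℕₚ.m∸n+n≡m h)

  divStep : Poly → Poly → Poly
  divStep f g = norm (f ⊕ shift (length f ∸ length g) g)

  divStep-monic : ∀ f′ g′ → length g′ ≤ length f′ → divStep (f′ ∷ʳ true) (g′ ∷ʳ true) ≡ divStep f′ g′
  divStep-monic f′ g′ h
    rewrite length-∷ʳ f′ true | length-∷ʳ g′ true | shift-∷ʳ (length f′ ∸ length g′) g′ true
          | ⊕-∷ʳ f′ (shift (length f′ ∸ length g′) g′) true true (sym (length-shift-∸ f′ g′ h))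
    = norm-∷ʳ-false (f′ ⊕ shift (length f′ ∸ length g′) g′)

  divStep-same-length : ∀ f g → length g ≡ length f → divStep f g ≡ norm (f ⊕ g)
  divStep-same-length f g g≡f rewrite g≡f | ℕₚ.n∸n≡0 (length f) = refl

  divStep-∷ : ∀ b q r′ e → length r′ + e ≡ length q → divStep (b ∷ q) r′ ≡ norm (b ∷ (q ⊕ shift e r′))
  divStep-∷ b q r′ e r+e≡q rewrite sym r+e≡q | sym (ℕₚ.+-suc (length r′) e) | ℕₚ.m+n∸m≡n (length r′) (suc e)
    | xor-identityʳ b = refl

  divStep-normal : ∀ f g → Normal (divStep f g)
  divStep-normal f g = norm-normal (f ⊕ shift (length f ∸ length g) g)

  length-divStep : ∀ f g → length g ≤ length f → length (divStep f g) ≤ length f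
  length-divStep f g h = ℕₚ.≤-trans (length-norm (f ⊕ shift (length f ∸ length g) g))
    (ℕₚ.≤-reflexive (length-⊕ f _ (ℕₚ.≤-reflexive (length-shift-∸ f g h))))

  divStep-shorter : ∀ f g′ → Normal f → length (g′ ∷ʳ true) ≤ length f →
    length (divStep f (g′ ∷ʳ true)) < length f
  divStep-shorter f g′ nf h with Normal⇒≡[]⊎monic f nf
  ... | inj₁ refl = ⊥-elim (ℕₚ.<⇒≱ (0<length-∷ʳ g′ true) h)
  divStep-shorter f g′ nf h | inj₂ (f′ , refl)
    = subst₂ _<_ (cong length (sym (divStep-monic f′ g′ h′))) (sym (length-∷ʳ f′ true))
        (s≤s (length-divStep f′ g′ h′))
    where h′ = ℕₚ.≤-pred (subst₂ _≤_ (length-∷ʳ g′ true) (length-∷ʳ f′ true) h)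

  modF-fuel : ∀ g′ k j f → Normal f → length f ≤ k → length f ≤ j →
    modF k f (g′ ∷ʳ true) ≡ modF j f (g′ ∷ʳ true)
  modF-fuel g′ zero zero f _ _ _ = refl
  modF-fuel g′ zero (suc j) [] _ _ _ rewrite length-∷ʳ g′ true = refl
  modF-fuel g′ (suc k) zero [] _ _ _ rewrite length-∷ʳ g′ true = refl
  modF-fuel g′ (suc k) (suc j) f nf hk hj
    with length (g′ ∷ʳ true) ≤ᵇ length f | ℕₚ.≤ᵇ-reflects-≤ (length (g′ ∷ʳ true)) (length f)
  ... | false | _ = refl
  ... | true | ofʸ g≤f = modF-fuel g′ k j _ (divStep-normal f (g′ ∷ʳ true)) (shorter hk) (shorter hj)
    where
    shorter : ∀ {m} → length f ≤ suc m → length (divStep f (g′ ∷ʳ true)) ≤ m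
    shorter h = ℕₚ.≤-pred (ℕₚ.≤-trans (divStep-shorter f g′ nf g≤f) h)

  modF-reduced : ∀ g′ k f → Normal f → length f ≤ k →
    Normal (modF k f (g′ ∷ʳ true)) × length (modF k f (g′ ∷ʳ true)) < length (g′ ∷ʳ true)
  modF-reduced g′ zero [] _ _ = refl , 0<length-∷ʳ g′ true
  modF-reduced g′ (suc k) f nf hk
    with length (g′ ∷ʳ true) ≤ᵇ length f | ℕₚ.≤ᵇ-reflects-≤ (length (g′ ∷ʳ true)) (length f)
  ... | false | ofⁿ g≰f = nf , ℕₚ.≰⇒> g≰f
  ... | true  | ofʸ g≤f =
    modF-reduced g′ k _ (divStep-normal f (g′ ∷ʳ true)) (ℕₚ.≤-pred (ℕₚ.≤-trans (divStep-shorter f g′ nf g≤f) hk))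

  mod-reduced : ∀ g′ f → Normal f →
    Normal (f mod (g′ ∷ʳ true)) × length (f mod (g′ ∷ʳ true)) < length (g′ ∷ʳ true)
  mod-reduced g′ f nf = modF-reduced g′ (length f) f nf ℕₚ.≤-refl

  mod-short : ∀ g′ f → length f < length (g′ ∷ʳ true) → f mod (g′ ∷ʳ true) ≡ f
  mod-short g′ [] _ = refl
  mod-short g′ (x ∷ xs) f<g
    with length (g′ ∷ʳ true) ≤ᵇ length (x ∷ xs) | ℕₚ.≤ᵇ-reflects-≤ (length (g′ ∷ʳ true)) (length (x ∷ xs))
  ... | false | _ = refl
  ... | true | ofʸ g≤f = ⊥-elim (ℕₚ.<⇒≱ f<g g≤f)

  norm-mod-short : ∀ g′ x → length x < length (g′ ∷ʳ true) → norm x mod (g′ ∷ʳ true) ≡ norm x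
  norm-mod-short g′ x x<g = mod-short g′ (norm x) (ℕₚ.≤-<-trans (length-norm x) x<g)

  mod-divStep : ∀ g′ f → Normal f → length (g′ ∷ʳ true) ≤ length f →
    f mod (g′ ∷ʳ true) ≡ divStep f (g′ ∷ʳ true) mod (g′ ∷ʳ true)
  mod-divStep g′ [] _ g≤f = ⊥-elim (ℕₚ.<⇒≱ (0<length-∷ʳ g′ true) g≤f)
  mod-divStep g′ (x ∷ xs) nf g≤f
    with length (g′ ∷ʳ true) ≤ᵇ length (x ∷ xs) | ℕₚ.≤ᵇ-reflects-≤ (length (g′ ∷ʳ true)) (length (x ∷ xs))
  ... | false | ofⁿ g≰f = ⊥-elim (g≰f g≤f)
  ... | true  | ofʸ _ =
    modF-fuel g′ (length xs) _ _ (divStep-normal (x ∷ xs) (g′ ∷ʳ true))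
      (ℕₚ.≤-pred (divStep-shorter (x ∷ xs) g′ nf g≤f)) ℕₚ.≤-refl

  mod-monic : ∀ q g′ → length g′ ≤ length q →
    (q ∷ʳ true) mod (g′ ∷ʳ true) ≡ divStep q g′ mod (g′ ∷ʳ true)
  mod-monic q g′ g≤q = trans
    (mod-divStep g′ (q ∷ʳ true) (norm-∷ʳ-true q)
       (subst₂ _≤_ (sym (length-∷ʳ g′ true)) (sym (length-∷ʳ q true)) (s≤s g≤q)))
    (cong (_mod (g′ ∷ʳ true)) (divStep-monic q g′ g≤q))

  gcdF-monic : ∀ k f g′ → gcdF (suc k) f (g′ ∷ʳ true) ≡ gcdF k (g′ ∷ʳ true) (f mod (g′ ∷ʳ true))
  gcdF-monic k f [] = refl
  gcdF-monic k f (_ ∷ _) = refl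

  gcdF-fuel : ∀ k j f g → Normal f → Normal g → length g < k → length g < j → gcdF k f g ≡ gcdF j f g
  gcdF-fuel (suc k) (suc j) f g nf ng g<k g<j with Normal⇒≡[]⊎monic g ng
  ... | inj₁ refl = refl
  ... | inj₂ (g′ , refl) = begin
    gcdF (suc k) f (g′ ∷ʳ true)     ≡⟨ gcdF-monic k f g′ ⟩
    gcdF k (g′ ∷ʳ true) r           ≡⟨ gcdF-fuel k j _ r ng nr (ℕₚ.<-≤-trans r<g (ℕₚ.≤-pred g<k))
                                                             (ℕₚ.<-≤-trans r<g (ℕₚ.≤-pred g<j)) ⟩
    gcdF j (g′ ∷ʳ true) r           ≡⟨ gcdF-monic j f g′ ⟨
    gcdF (suc j) f (g′ ∷ʳ true)     ∎
    where
    open ≡-Reasoning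
    r = f mod (g′ ∷ʳ true)
    nr = proj₁ (mod-reduced g′ f nf)
    r<g = proj₂ (mod-reduced g′ f nf)

  -- Euclid's algorithm with fuel depending on g only, so that a division step is an equation.
  euclid : Poly → Poly → Poly
  euclid f g = gcdF (suc (length g)) f g

  euclid-monic : ∀ f g′ → Normal f → euclid f (g′ ∷ʳ true) ≡ euclid (g′ ∷ʳ true) (f mod (g′ ∷ʳ true))
  euclid-monic f g′ nf = trans (gcdF-monic (length (g′ ∷ʳ true)) f g′)
    (gcdF-fuel _ _ (g′ ∷ʳ true) _ (norm-∷ʳ-true g′) (proj₁ reduced) (proj₂ reduced) ℕₚ.≤-refl)
    where reduced = mod-reduced g′ f nf

  gcd≡euclid : ∀ f g → Normal f → Normal g → gcd f g ≡ euclid f g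
  gcd≡euclid f g nf ng rewrite nf | ng =
    gcdF-fuel _ _ f g nf ng (s≤s (ℕₚ.m≤n+m (length g) (length f))) ℕₚ.≤-refl

module Counting where

  open import Defs
  open Euclid
  open import Data.Bool using (Bool; true; false; if_then_else_; _xor_)
  open import Data.Nat using (ℕ; zero; suc; _+_; _*_; _^_; _∸_; _≤_; _<_; s≤s)
  import Data.Nat.Properties as ℕₚ
  open import Data.List using (List; []; _∷_; _++_; _∷ʳ_; length; map; filter; cartesianProduct; last)
  open import Data.Maybe using (just)
  open import Data.Nat.Induction using (<-rec)
  open import Data.Product using (_,_; proj₂)
  open import Function using (_∘_)
  open import Relation.Nullary using (Dec; does)
  open import Relation.Nullary.Decidable using (dec-false)
  open import Relation.Binary.PropositionalEquality
  open import Algebra.Properties.CommutativeSemigroup ℕₚ.+-commutativeSemigroup using (interchange)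
  open import Data.Nat.Tactic.RingSolver using (solve-∀)

  private variable X Y : Set

  ∑ : List X → (X → ℕ) → ℕ
  ∑ [] F = 0
  ∑ (x ∷ xs) F = F x + ∑ xs F

  syntax ∑ xs (λ x → e) = ∑[ x ∈ xs ] e

  ∑-++ : ∀ (xs ys : List X) F → ∑ (xs ++ ys) F ≡ ∑ xs F + ∑ ys F
  ∑-++ [] ys F = refl
  ∑-++ (x ∷ xs) ys F = trans (cong (F x +_) (∑-++ xs ys F)) (sym (ℕₚ.+-assoc (F x) _ _))

  ∑-cong : ∀ (xs : List X) {F G : X → ℕ} → (∀ x → F x ≡ G x) → ∑ xs F ≡ ∑ xs G
  ∑-cong [] _ = refl
  ∑-cong (x ∷ xs) F≗G = cong₂ _+_ (F≗G x) (∑-cong xs F≗G)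

  ∑-distrib-+ : ∀ (xs : List X) F G → ∑[ x ∈ xs ] (F x + G x) ≡ ∑ xs F + ∑ xs G
  ∑-distrib-+ [] F G = refl
  ∑-distrib-+ (x ∷ xs) F G =
    trans (cong (F x + G x +_) (∑-distrib-+ xs F G)) (interchange (F x) (G x) _ _)

  ∑-*ˡ : ∀ (xs : List X) c F → ∑[ x ∈ xs ] (c * F x) ≡ c * ∑ xs F
  ∑-*ˡ [] c F = sym (ℕₚ.*-zeroʳ c)
  ∑-*ˡ (x ∷ xs) c F = trans (cong (c * F x +_) (∑-*ˡ xs c F)) (sym (ℕₚ.*-distribˡ-+ c (F x) _))

  ∑-0 : ∀ (xs : List X) → ∑[ x ∈ xs ] 0 ≡ 0
  ∑-0 [] = refl
  ∑-0 (x ∷ xs) = ∑-0 xs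

  ∑-comm : ∀ (xs : List X) (ys : List Y) (F : X → Y → ℕ) →
    ∑[ x ∈ xs ] ∑ ys (F x) ≡ ∑[ y ∈ ys ] ∑[ x ∈ xs ] F x y
  ∑-comm [] ys F = sym (∑-0 ys)
  ∑-comm (x ∷ xs) ys F = trans (cong (∑ ys (F x) +_) (∑-comm xs ys F))
    (sym (∑-distrib-+ ys (F x) (λ y → ∑[ x ∈ xs ] F x y)))

  ∑-filter : ∀ {P : X → Set} (P? : ∀ x → Dec (P x)) xs F →
    ∑ (filter P? xs) F ≡ ∑[ x ∈ xs ] (if does (P? x) then F x else 0)
  ∑-filter P? [] F = refl
  ∑-filter P? (x ∷ xs) F with does (P? x)
  ... | true  = cong (F x +_) (∑-filter P? xs F)
  ... | false = ∑-filter P? xs F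

  length≡∑1 : ∀ (xs : List X) → length xs ≡ ∑[ x ∈ xs ] 1
  length≡∑1 [] = refl
  length≡∑1 (x ∷ xs) = cong suc (length≡∑1 xs)

  ∑-map : ∀ (g : X → Y) xs F → ∑ (map g xs) F ≡ ∑ xs (F ∘ g)
  ∑-map g [] F = refl
  ∑-map g (x ∷ xs) F = cong (F (g x) +_) (∑-map g xs F)

  ∑-cartesianProduct : ∀ (xs : List X) (ys : List Y) F →
    ∑ (cartesianProduct xs ys) F ≡ ∑[ x ∈ xs ] ∑[ y ∈ ys ] F (x , y)
  ∑-cartesianProduct [] ys F = refl
  ∑-cartesianProduct (x ∷ xs) ys F = trans (∑-++ (map (x ,_) ys) _ F)
    (cong₂ _+_ (∑-map (x ,_) ys F) (∑-cartesianProduct xs ys F))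

  ∑< : ℕ → (ℕ → ℕ) → ℕ
  ∑< zero f = 0
  ∑< (suc K) f = ∑< K f + f K

  syntax ∑< K (λ j → e) = ∑[ j < K ] e

  ∑<-cong : ∀ K {f g} → (∀ j → j < K → f j ≡ g j) → ∑< K f ≡ ∑< K g
  ∑<-cong zero _ = refl
  ∑<-cong (suc K) f≗g = cong₂ _+_ (∑<-cong K (λ j j<K → f≗g j (ℕₚ.m<n⇒m<1+n j<K))) (f≗g K ℕₚ.≤-refl)

  ∑<-*ˡ : ∀ K c f → ∑[ j < K ] (c * f j) ≡ c * ∑< K f
  ∑<-*ˡ zero c f = sym (ℕₚ.*-zeroʳ c)
  ∑<-*ˡ (suc K) c f = trans (cong (_+ c * f K) (∑<-*ˡ K c f)) (sym (ℕₚ.*-distribˡ-+ c (∑< K f) (f K)))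

  ∑-∑<-comm : ∀ (xs : List X) K (F : X → ℕ → ℕ) → ∑[ x ∈ xs ] ∑< K (F x) ≡ ∑[ j < K ] ∑[ x ∈ xs ] F x j
  ∑-∑<-comm xs zero F = ∑-0 xs
  ∑-∑<-comm xs (suc K) F = trans (∑-distrib-+ xs (λ x → ∑< K (F x)) (λ x → F x K))
    (cong (_+ ∑[ x ∈ xs ] F x K) (∑-∑<-comm xs K F))

  ∑-allLists-∷ : ∀ m (F : Poly → ℕ) →
    ∑ (allLists (suc m)) F ≡ ∑[ p ∈ allLists m ] F (true ∷ p) + ∑[ p ∈ allLists m ] F (false ∷ p)
  ∑-allLists-∷ m F = trans (∑-++ (map (true ∷_) (allLists m)) _ F)
    (cong₂ _+_ (∑-map (true ∷_) (allLists m) F)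
      (trans (∑-++ (map (false ∷_) (allLists m)) [] F)
        (trans (ℕₚ.+-identityʳ _) (∑-map (false ∷_) (allLists m) F))))

  ∑-allLists-∷ʳ : ∀ m (F : Poly → ℕ) →
    ∑ (allLists (suc m)) F ≡ ∑[ q ∈ allLists m ] F (q ∷ʳ true) + ∑[ q ∈ allLists m ] F (q ∷ʳ false)
  ∑-allLists-∷ʳ zero F = cong (_+ (F (false ∷ []) + 0)) (sym (ℕₚ.+-identityʳ (F (true ∷ []))))
  ∑-allLists-∷ʳ (suc m) F = begin
    ∑ (allLists (suc (suc m))) F
      ≡⟨ ∑-allLists-∷ (suc m) F ⟩
    ∑ (allLists (suc m)) (F ∘ (true ∷_)) + ∑ (allLists (suc m)) (F ∘ (false ∷_))
      ≡⟨ cong₂ _+_ (∑-allLists-∷ʳ m (F ∘ (true ∷_))) (∑-allLists-∷ʳ m (F ∘ (false ∷_))) ⟩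
    (Σₘ λ q → F (true ∷ q ∷ʳ true)) + (Σₘ λ q → F (true ∷ q ∷ʳ false)) +
      ((Σₘ λ q → F (false ∷ q ∷ʳ true)) + (Σₘ λ q → F (false ∷ q ∷ʳ false)))
      ≡⟨ interchange (Σₘ λ q → F (true ∷ q ∷ʳ true)) _ _ _ ⟩
    (Σₘ λ q → F (true ∷ q ∷ʳ true)) + (Σₘ λ q → F (false ∷ q ∷ʳ true)) +
      ((Σₘ λ q → F (true ∷ q ∷ʳ false)) + (Σₘ λ q → F (false ∷ q ∷ʳ false)))
      ≡⟨ cong₂ _+_ (∑-allLists-∷ m (λ q → F (q ∷ʳ true))) (∑-allLists-∷ m (λ q → F (q ∷ʳ false))) ⟨
    ∑[ q ∈ allLists (suc m) ] F (q ∷ʳ true) + ∑[ q ∈ allLists (suc m) ] F (q ∷ʳ false) ∎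
    where
    open ≡-Reasoning
    Σₘ : (Poly → ℕ) → ℕ
    Σₘ = ∑ (allLists m)

  ∑-allLists-⊕ : ∀ m v (F : Poly → ℕ) → length v ≤ m → ∑[ p ∈ allLists m ] F (p ⊕ v) ≡ ∑ (allLists m) F
  ∑-allLists-⊕ m [] F _ = ∑-cong (allLists m) (λ p → cong F (⊕-identityʳ p))
  ∑-allLists-⊕ (suc m) (c ∷ v) F (s≤s v≤m) = begin
    ∑[ p ∈ allLists (suc m) ] F (p ⊕ (c ∷ v))
      ≡⟨ ∑-allLists-∷ m (λ p → F (p ⊕ (c ∷ v))) ⟩
    ∑[ p ∈ allLists m ] F ((true xor c) ∷ (p ⊕ v)) + ∑[ p ∈ allLists m ] F ((false xor c) ∷ (p ⊕ v))
      ≡⟨ cong₂ _+_ (∑-allLists-⊕ m v (F ∘ ((true xor c) ∷_)) v≤m)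
                   (∑-allLists-⊕ m v (F ∘ ((false xor c) ∷_)) v≤m) ⟩
    ∑[ p ∈ allLists m ] F ((true xor c) ∷ p) + ∑[ p ∈ allLists m ] F ((false xor c) ∷ p)
      ≡⟨ flip c ⟩
    ∑[ p ∈ allLists m ] F (true ∷ p) + ∑[ p ∈ allLists m ] F (false ∷ p)
      ≡⟨ ∑-allLists-∷ m F ⟨
    ∑ (allLists (suc m)) F ∎
    where
    open ≡-Reasoning
    flip : ∀ c → ∑[ p ∈ allLists m ] F ((true xor c) ∷ p) + ∑[ p ∈ allLists m ] F ((false xor c) ∷ p)
               ≡ ∑[ p ∈ allLists m ] F (true ∷ p) + ∑[ p ∈ allLists m ] F (false ∷ p)
    flip true  = ℕₚ.+-comm (∑[ p ∈ allLists m ] F (false ∷ p)) _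
    flip false = refl

  ∑-allLists-const : ∀ m c → ∑[ p ∈ allLists m ] c ≡ 2 ^ m * c
  ∑-allLists-const zero c = refl
  ∑-allLists-const (suc m) c = trans (∑-allLists-∷ m (λ _ → c))
    (trans (cong₂ _+_ (∑-allLists-const m c) (∑-allLists-const m c)) (double (2 ^ m) c))
    where
    double : ∀ a c → a * c + a * c ≡ (2 * a) * c
    double = solve-∀

  ∑-allLists-cong : ∀ m {F G : Poly → ℕ} → (∀ p → length p ≡ m → F p ≡ G p) →
    ∑ (allLists m) F ≡ ∑ (allLists m) G
  ∑-allLists-cong zero F≗G = cong (_+ 0) (F≗G [] refl)
  ∑-allLists-cong (suc m) {F} {G} F≗G = trans (∑-allLists-∷ m F) (trans
    (cong₂ _+_ (∑-allLists-cong m (λ p e → F≗G (true ∷ p) (cong suc e)))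
               (∑-allLists-cong m (λ p e → F≗G (false ∷ p) (cong suc e))))
    (sym (∑-allLists-∷ m G)))

  ∑-mod-extend : ∀ r′ (h : Poly → ℕ) b e →
    ∑[ u ∈ allLists (length r′ + e) ] h (norm (b ∷ u) mod (r′ ∷ʳ true)) ≡
    2 ^ e * ∑[ u ∈ allLists (length r′) ] h (norm (b ∷ u) mod (r′ ∷ʳ true))
  ∑-mod-extend r′ h b zero rewrite ℕₚ.+-identityʳ (length r′) = sym (ℕₚ.*-identityˡ _)
  ∑-mod-extend r′ h b (suc e) rewrite ℕₚ.+-suc (length r′) e = begin
    ∑ (allLists (suc (d + e))) F
      ≡⟨ ∑-allLists-∷ʳ (d + e) F ⟩
    ∑[ q ∈ allLists (d + e) ] F (q ∷ʳ true) + ∑[ q ∈ allLists (d + e) ] F (q ∷ʳ false)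
      ≡⟨ cong₂ _+_ top-true top-false ⟩
    ∑ (allLists (d + e)) F + ∑ (allLists (d + e)) F
      ≡⟨ cong (λ z → z + z) (∑-mod-extend r′ h b e) ⟩
    2 ^ e * ∑ (allLists d) F + 2 ^ e * ∑ (allLists d) F
      ≡⟨ double (2 ^ e) _ ⟩
    2 ^ suc e * ∑ (allLists d) F ∎
    where
    open ≡-Reasoning
    d = length r′
    r = r′ ∷ʳ true
    F : Poly → ℕ
    F u = h (norm (b ∷ u) mod r)
    double : ∀ a x → a * x + a * x ≡ (2 * a) * x
    double = solve-∀
    top-true : ∑[ q ∈ allLists (d + e) ] F (q ∷ʳ true) ≡ ∑ (allLists (d + e)) F
    top-true = trans
      (∑-allLists-cong (d + e) λ q ∣q∣ → cong h (begin
        norm (b ∷ q ∷ʳ true) mod r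
          ≡⟨ cong (_mod r) (norm-∷ʳ-true (b ∷ q)) ⟩
        (b ∷ q ∷ʳ true) mod r
          ≡⟨ mod-monic (b ∷ q) r′ (ℕₚ.m≤n⇒m≤1+n (subst (d ≤_) (sym ∣q∣) (ℕₚ.m≤m+n d e))) ⟩
        divStep (b ∷ q) r′ mod r
          ≡⟨ cong (_mod r) (divStep-∷ b q r′ e (sym ∣q∣)) ⟩
        norm (b ∷ (q ⊕ shift e r′)) mod r ∎))
      (∑-allLists-⊕ (d + e) (shift e r′) F
        (ℕₚ.≤-reflexive (trans (length-shift e r′) (ℕₚ.+-comm e d))))
    top-false : ∑[ q ∈ allLists (d + e) ] F (q ∷ʳ false) ≡ ∑ (allLists (d + e)) F
    top-false = ∑-cong (allLists (d + e)) (λ q → cong (λ z → h (z mod r)) (norm-∷ʳ-false (b ∷ q)))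

  ∑-mod-base : ∀ a q₀ (h : Poly → ℕ) b →
    ∑[ u ∈ allLists (suc (length q₀)) ] h (norm (b ∷ u) mod ((a ∷ q₀) ∷ʳ true)) ≡
    ∑[ u ∈ allLists (length q₀) ] h (norm ((b xor a) ∷ u)) + ∑[ u ∈ allLists (length q₀) ] h (norm (b ∷ u))
  ∑-mod-base a q₀ h b = trans (∑-allLists-∷ʳ j F) (cong₂ _+_ top-true top-false)
    where
    open ≡-Reasoning
    j = length q₀
    r = (a ∷ q₀) ∷ʳ true
    F : Poly → ℕ
    F u = h (norm (b ∷ u) mod r)
    reduced : ∀ x → length x ≤ suc j → norm x mod r ≡ norm x
    reduced x ∣x∣ = norm-mod-short (a ∷ q₀) x (subst (length x <_) (sym (length-∷ʳ (a ∷ q₀) true)) (s≤s ∣x∣))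
    top-true : ∑[ q ∈ allLists j ] F (q ∷ʳ true) ≡ ∑[ u ∈ allLists j ] h (norm ((b xor a) ∷ u))
    top-true = trans
      (∑-allLists-cong j λ q ∣q∣ → cong h (begin
        norm (b ∷ q ∷ʳ true) mod r
          ≡⟨ cong (_mod r) (norm-∷ʳ-true (b ∷ q)) ⟩
        (b ∷ q ∷ʳ true) mod r
          ≡⟨ mod-monic (b ∷ q) (a ∷ q₀) (s≤s (ℕₚ.≤-reflexive (sym ∣q∣))) ⟩
        divStep (b ∷ q) (a ∷ q₀) mod r
          ≡⟨ cong (_mod r) (divStep-same-length (b ∷ q) (a ∷ q₀) (cong suc (sym ∣q∣))) ⟩
        norm ((b xor a) ∷ (q ⊕ q₀)) mod r
          ≡⟨ reduced ((b xor a) ∷ (q ⊕ q₀))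
               (s≤s (ℕₚ.≤-reflexive (trans (length-⊕ q q₀ (ℕₚ.≤-reflexive (sym ∣q∣))) ∣q∣))) ⟩
        norm ((b xor a) ∷ (q ⊕ q₀)) ∎))
      (∑-allLists-⊕ j q₀ (λ u → h (norm ((b xor a) ∷ u))) ℕₚ.≤-refl)
    top-false : ∑[ q ∈ allLists j ] F (q ∷ʳ false) ≡ ∑[ u ∈ allLists j ] h (norm (b ∷ u))
    top-false = ∑-allLists-cong j λ q ∣q∣ →
      cong h (trans (cong (_mod r) (norm-∷ʳ-false (b ∷ q))) (reduced (b ∷ q) (s≤s (ℕₚ.≤-reflexive ∣q∣))))

  ∑-by-degree : ∀ K a (h : Poly → ℕ) →
    ∑[ s ∈ allLists K ] h (norm (a ∷ s)) ≡ h (norm (a ∷ [])) + ∑[ j < K ] ∑[ q ∈ allLists j ] h ((a ∷ q) ∷ʳ true)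
  ∑-by-degree zero a h = refl
  ∑-by-degree (suc K) a h = begin
    ∑[ s ∈ allLists (suc K) ] h (norm (a ∷ s))
      ≡⟨ ∑-allLists-∷ʳ K (λ s → h (norm (a ∷ s))) ⟩
    ∑[ q ∈ allLists K ] h (norm (a ∷ q ∷ʳ true)) + ∑[ q ∈ allLists K ] h (norm (a ∷ q ∷ʳ false))
      ≡⟨ cong₂ _+_ (∑-cong (allLists K) (λ q → cong h (norm-∷ʳ-true (a ∷ q))))
                   (trans (∑-cong (allLists K) (λ q → cong h (norm-∷ʳ-false (a ∷ q)))) (∑-by-degree K a h)) ⟩
    top + (h (norm (a ∷ [])) + ∑[ j < K ] ∑[ q ∈ allLists j ] h ((a ∷ q) ∷ʳ true))
      ≡⟨ rotate top (h (norm (a ∷ []))) _ ⟩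
    h (norm (a ∷ [])) + ∑[ j < suc K ] ∑[ q ∈ allLists j ] h ((a ∷ q) ∷ʳ true) ∎
    where
    open ≡-Reasoning
    top = ∑[ q ∈ allLists K ] h ((a ∷ q) ∷ʳ true)
    rotate : ∀ x y z → x + (y + z) ≡ y + (z + x)
    rotate = solve-∀

  ∑-remainders : ∀ K b a q (h : Poly → ℕ) → length q < K →
    ∑[ t ∈ allLists K ] h (((b ∷ t) ∷ʳ true) mod ((a ∷ q) ∷ʳ true)) ≡
    2 ^ (K ∸ suc (length q)) *
      (∑[ u ∈ allLists (length q) ] h (norm ((b xor a) ∷ u)) + ∑[ u ∈ allLists (length q) ] h (norm (b ∷ u)))
  ∑-remainders K b a q h q<K = begin
    ∑[ t ∈ allLists K ] h (((b ∷ t) ∷ʳ true) mod r)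
      ≡⟨ ∑-allLists-cong K (λ t ∣t∣ → cong h (begin
           ((b ∷ t) ∷ʳ true) mod r
             ≡⟨ mod-monic (b ∷ t) (a ∷ q) (s≤s (subst (length q ≤_) (sym ∣t∣) (ℕₚ.<⇒≤ q<K))) ⟩
           divStep (b ∷ t) (a ∷ q) mod r
             ≡⟨ cong (_mod r) (divStep-∷ b t (a ∷ q) e (trans K≡ (sym ∣t∣))) ⟩
           norm (b ∷ (t ⊕ shift e (a ∷ q))) mod r ∎)) ⟩
    ∑[ t ∈ allLists K ] F (t ⊕ shift e (a ∷ q))
      ≡⟨ ∑-allLists-⊕ K (shift e (a ∷ q)) F
           (ℕₚ.≤-reflexive (trans (length-shift e (a ∷ q)) (trans (ℕₚ.+-comm e _) K≡))) ⟩
    ∑ (allLists K) F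
      ≡⟨ cong (λ n → ∑ (allLists n) F) (sym K≡) ⟩
    ∑ (allLists (suc (length q) + e)) F
      ≡⟨ ∑-mod-extend (a ∷ q) h b e ⟩
    2 ^ e * ∑ (allLists (suc (length q))) F
      ≡⟨ cong (2 ^ e *_) (∑-mod-base a q h b) ⟩
    2 ^ e * (∑[ u ∈ allLists (length q) ] h (norm ((b xor a) ∷ u)) + ∑[ u ∈ allLists (length q) ] h (norm (b ∷ u))) ∎
    where
    open ≡-Reasoning
    r = (a ∷ q) ∷ʳ true
    e = K ∸ suc (length q)
    K≡ : suc (length q) + e ≡ K
    K≡ = ℕₚ.m+[n∸m]≡n q<K
    F : Poly → ℕ
    F u = h (norm (b ∷ u) mod r)

  isOne : Poly → ℕ
  isOne p = if does (p ≟P one) then 1 else 0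

  coprimality : Poly → Poly → ℕ
  coprimality f g = isOne (euclid f g)

  bit : Bool → ℕ
  bit true  = 1
  bit false = 0

  -- the number of coprime pairs (f , g) with deg f = K + 1, f(0) = b, deg g ≤ K, g(0) = a
  coprimeCount : ℕ → Bool → Bool → ℕ
  coprimeCount K b a = ∑[ t ∈ allLists K ] ∑[ s ∈ allLists K ] coprimality ((b ∷ t) ∷ʳ true) (norm (a ∷ s))

  isOne-long : ∀ b c p → isOne (b ∷ c ∷ p) ≡ 0
  isOne-long b c p = cong (if_then 1 else 0) (dec-false ((b ∷ c ∷ p) ≟P one) λ ())

  coprimality-constant : ∀ b t a → coprimality ((b ∷ t) ∷ʳ true) (norm (a ∷ [])) ≡ bit a
  coprimality-constant b t true =
    cong (λ r → isOne (gcdF 1 (true ∷ []) r))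
      (length<1⇒[] (f mod (true ∷ [])) (proj₂ (mod-reduced [] f (norm-∷ʳ-true (b ∷ t)))))
    where
    f = (b ∷ t) ∷ʳ true
    length<1⇒[] : ∀ (p : Poly) → length p < 1 → p ≡ []
    length<1⇒[] [] _ = refl
    length<1⇒[] (_ ∷ _) (s≤s ())
  coprimality-constant b [] false = isOne-long b true []
  coprimality-constant b (c ∷ t) false = isOne-long b c (t ∷ʳ true)

  coprimeCount-rec : ∀ K b a → coprimeCount K b a ≡
    2 ^ K * bit a + ∑[ j < K ] (2 ^ (K ∸ suc j) * (coprimeCount j a (b xor a) + coprimeCount j a b))
  coprimeCount-rec K b a = begin
    coprimeCount K b a
      ≡⟨ ∑-cong (allLists K) by-degree ⟩
    ∑[ t ∈ allLists K ] (bit a + ∑[ j < K ] D t j)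
      ≡⟨ ∑-distrib-+ (allLists K) (λ _ → bit a) (λ t → ∑< K (D t)) ⟩
    ∑[ t ∈ allLists K ] bit a + ∑[ t ∈ allLists K ] ∑< K (D t)
      ≡⟨ cong₂ _+_ (∑-allLists-const K (bit a)) (∑-∑<-comm (allLists K) K D) ⟩
    2 ^ K * bit a + ∑[ j < K ] ∑[ t ∈ allLists K ] D t j
      ≡⟨ cong (2 ^ K * bit a +_) (∑<-cong K per-degree) ⟩
    2 ^ K * bit a + ∑[ j < K ] (2 ^ (K ∸ suc j) * (coprimeCount j a (b xor a) + coprimeCount j a b)) ∎
    where
    open ≡-Reasoning
    f : Poly → Poly
    f t = (b ∷ t) ∷ʳ true
    r : Poly → Poly
    r q = (a ∷ q) ∷ʳ true
    D : Poly → ℕ → ℕ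
    D t j = ∑[ q ∈ allLists j ] coprimality (r q) (f t mod r q)
    by-degree : ∀ t → ∑[ s ∈ allLists K ] coprimality (f t) (norm (a ∷ s)) ≡ bit a + ∑[ j < K ] D t j
    by-degree t = trans (∑-by-degree K a (coprimality (f t)))
      (cong₂ _+_ (coprimality-constant b t a)
        (∑<-cong K λ j _ → ∑-cong (allLists j) λ q → cong isOne (euclid-monic (f t) (a ∷ q) (norm-∷ʳ-true (b ∷ t)))))
    remainders : ∀ j → j < K → ∀ q → length q ≡ j →
      ∑[ t ∈ allLists K ] coprimality (r q) (f t mod r q) ≡ 2 ^ (K ∸ suc j) *
        (∑[ u ∈ allLists j ] coprimality (r q) (norm ((b xor a) ∷ u)) + ∑[ u ∈ allLists j ] coprimality (r q) (norm (b ∷ u)))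
    remainders j j<K q refl = ∑-remainders K b a q (coprimality (r q)) j<K
    per-degree : ∀ j → j < K →
      ∑[ t ∈ allLists K ] D t j ≡ 2 ^ (K ∸ suc j) * (coprimeCount j a (b xor a) + coprimeCount j a b)
    per-degree j j<K = begin
      ∑[ t ∈ allLists K ] D t j
        ≡⟨ ∑-comm (allLists K) (allLists j) (λ t q → coprimality (r q) (f t mod r q)) ⟩
      ∑[ q ∈ allLists j ] ∑[ t ∈ allLists K ] coprimality (r q) (f t mod r q)
        ≡⟨ ∑-allLists-cong j (remainders j j<K) ⟩
      ∑[ q ∈ allLists j ] (2 ^ (K ∸ suc j) * (N (b xor a) q + N b q))
        ≡⟨ ∑-*ˡ (allLists j) (2 ^ (K ∸ suc j)) (λ q → N (b xor a) q + N b q) ⟩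
      2 ^ (K ∸ suc j) * ∑[ q ∈ allLists j ] (N (b xor a) q + N b q)
        ≡⟨ cong (2 ^ (K ∸ suc j) *_) (∑-distrib-+ (allLists j) (N (b xor a)) (N b)) ⟩
      2 ^ (K ∸ suc j) * (coprimeCount j a (b xor a) + coprimeCount j a b) ∎
      where
      N : Bool → Poly → ℕ
      N c q = ∑[ u ∈ allLists j ] coprimality (r q) (norm (c ∷ u))

  geom4 : ℕ → ℕ
  geom4 zero    = 0
  geom4 (suc m) = 4 * geom4 m + 1

  horner2 : ℕ → (ℕ → ℕ) → ℕ
  horner2 zero    c = 0
  horner2 (suc K) c = 2 * horner2 K c + c K

  ∑<-horner2 : ∀ K c → ∑[ j < K ] (2 ^ (K ∸ suc j) * c j) ≡ horner2 K c
  ∑<-horner2 zero c = refl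
  ∑<-horner2 (suc K) c = cong₂ _+_
    (trans (∑<-cong K λ j j<K → trans (cong (λ z → 2 ^ z * c j) (ℕₚ.+-∸-assoc 1 j<K))
                                      (ℕₚ.*-assoc 2 (2 ^ (K ∸ suc j)) (c j)))
      (trans (∑<-*ˡ K 2 (λ j → 2 ^ (K ∸ suc j) * c j)) (cong (2 *_) (∑<-horner2 K c))))
    (trans (cong (λ z → 2 ^ z * c K) (ℕₚ.n∸n≡0 K)) (ℕₚ.+-identityʳ (c K)))

  horner2-cong : ∀ K {c d} → (∀ j → c j ≡ d j) → horner2 K c ≡ horner2 K d
  horner2-cong zero    _   = refl
  horner2-cong (suc K) c≗d = cong₂ _+_ (cong (2 *_) (horner2-cong K c≗d)) (c≗d K)

  closedCount : ℕ → Bool → Bool → ℕ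
  closedCount K false false = 0
  closedCount K true  false = 2 * geom4 K
  closedCount K _     true  = 2 * geom4 K + 1

  closedCount-rec : ∀ K b a →
    2 ^ K * bit a + horner2 K (λ j → closedCount j a (b xor a) + closedCount j a b) ≡ closedCount K b a
  closedCount-rec K false false = trans (cong₂ _+_ (ℕₚ.*-zeroʳ (2 ^ K)) refl) (horner2-0 K)
    where
    horner2-0 : ∀ K → horner2 K (λ _ → 0) ≡ 0
    horner2-0 zero = refl
    horner2-0 (suc K) rewrite horner2-0 K = refl
  closedCount-rec K true false = trans (cong₂ _+_ (ℕₚ.*-zeroʳ (2 ^ K)) refl) (even K)
    where
    even : ∀ K → horner2 K (λ j → (2 * geom4 j + 1) + (2 * geom4 j + 1)) ≡ 2 * geom4 K
    even zero = refl
    even (suc K) rewrite even K = step (geom4 K)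
      where
      step : ∀ w → 2 * (2 * w) + ((2 * w + 1) + (2 * w + 1)) ≡ 2 * (4 * w + 1)
      step = solve-∀
  closedCount-rec K false true = trans (cong₂ _+_ (ℕₚ.*-identityʳ (2 ^ K)) refl) (odd K)
    where
    odd : ∀ K → 2 ^ K + horner2 K (λ j → (2 * geom4 j + 1) + 2 * geom4 j) ≡ 2 * geom4 K + 1
    odd zero = refl
    odd (suc K) = trans (regroup (2 ^ K) (horner2 K _) (geom4 K))
      (trans (cong (λ z → 2 * z + (4 * geom4 K + 1)) (odd K)) (finish (geom4 K)))
      where
      regroup : ∀ p s w → 2 * p + (2 * s + ((2 * w + 1) + 2 * w)) ≡ 2 * (p + s) + (4 * w + 1)
      regroup = solve-∀
      finish : ∀ w → 2 * (2 * w + 1) + (4 * w + 1) ≡ 2 * (4 * w + 1) + 1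
      finish = solve-∀
  closedCount-rec K true true =
    trans (cong (2 ^ K * 1 +_) (horner2-cong K λ j → ℕₚ.+-comm (2 * geom4 j) (2 * geom4 j + 1)))
          (closedCount-rec K false true)

  coprimeCount≡closedCount : ∀ K b a → coprimeCount K b a ≡ closedCount K b a
  coprimeCount≡closedCount = <-rec _ λ K ih b a → begin
    coprimeCount K b a
      ≡⟨ coprimeCount-rec K b a ⟩
    2 ^ K * bit a + ∑[ j < K ] (2 ^ (K ∸ suc j) * (coprimeCount j a (b xor a) + coprimeCount j a b))
      ≡⟨ cong (2 ^ K * bit a +_) (∑<-cong K λ j j<K →
           cong (2 ^ (K ∸ suc j) *_) (cong₂ _+_ (ih j<K a (b xor a)) (ih j<K a b))) ⟩
    2 ^ K * bit a + ∑[ j < K ] (2 ^ (K ∸ suc j) * (closedCount j a (b xor a) + closedCount j a b))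
      ≡⟨ cong (2 ^ K * bit a +_) (∑<-horner2 K _) ⟩
    2 ^ K * bit a + horner2 K (λ j → closedCount j a (b xor a) + closedCount j a b)
      ≡⟨ closedCount-rec K b a ⟩
    closedCount K b a ∎
    where open ≡-Reasoning

  ∑-S : ∀ m (F : Poly → ℕ) → ∑ (S (suc m)) F ≡ ∑[ s ∈ allLists m ] F ((true ∷ s) ∷ʳ true)
  ∑-S m F = begin
    ∑ (S (suc m)) F
      ≡⟨ ∑-filter isS? (allLists (suc (suc m))) F ⟩
    ∑[ p ∈ allLists (suc (suc m)) ] G p
      ≡⟨ ∑-allLists-∷ (suc m) G ⟩
    ∑[ p ∈ allLists (suc m) ] G (true ∷ p) + ∑[ p ∈ allLists (suc m) ] 0
      ≡⟨ cong₂ _+_ (∑-allLists-∷ʳ m (G ∘ (true ∷_))) (∑-0 (allLists (suc m))) ⟩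
    ∑[ s ∈ allLists m ] G (true ∷ s ∷ʳ true) + ∑[ s ∈ allLists m ] G (true ∷ s ∷ʳ false) + 0
      ≡⟨ cong (_+ 0) (cong₂ _+_ (∑-cong (allLists m) G-∷ʳ-true)
                                (trans (∑-cong (allLists m) G-∷ʳ-false) (∑-0 (allLists m)))) ⟩
    ∑[ s ∈ allLists m ] F (true ∷ s ∷ʳ true) + 0 + 0
      ≡⟨ trans (ℕₚ.+-identityʳ _) (ℕₚ.+-identityʳ _) ⟩
    ∑[ s ∈ allLists m ] F ((true ∷ s) ∷ʳ true) ∎
    where
    open ≡-Reasoning
    G : Poly → ℕ
    G p = if does (isS? p) then F p else 0
    last-∷ʳ : ∀ (x : Bool) q c → last (x ∷ q ∷ʳ c) ≡ just c
    last-∷ʳ x [] c = refl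
    last-∷ʳ x (y ∷ q) c = last-∷ʳ y q c
    isS-∷ʳ : ∀ q c → does (isS? (true ∷ q ∷ʳ c)) ≡ c
    isS-∷ʳ q c rewrite last-∷ʳ true q c with c
    ... | true  = refl
    ... | false = refl
    G-∷ʳ-true : ∀ s → G (true ∷ s ∷ʳ true) ≡ F (true ∷ s ∷ʳ true)
    G-∷ʳ-true s = cong (if_then F (true ∷ s ∷ʳ true) else 0) (isS-∷ʳ s true)
    G-∷ʳ-false : ∀ s → G (true ∷ s ∷ʳ false) ≡ 0
    G-∷ʳ-false s = cong (if_then F (true ∷ s ∷ʳ false) else 0) (isS-∷ʳ s false)

  length-A : ∀ m → length (A (suc m)) ≡ 2 * geom4 m
  length-A m = begin
    length (A (suc m))
      ≡⟨ length≡∑1 (A (suc m)) ⟩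
    ∑[ p ∈ A (suc m) ] 1
      ≡⟨ ∑-filter coprime? (cartesianProduct (S (suc m)) (S (suc m))) (λ _ → 1) ⟩
    ∑[ p ∈ cartesianProduct (S (suc m)) (S (suc m)) ] (if does (coprime? p) then 1 else 0)
      ≡⟨ ∑-cartesianProduct (S (suc m)) (S (suc m)) _ ⟩
    ∑[ f ∈ S (suc m) ] ∑[ g ∈ S (suc m) ] isOne (gcd f g)
      ≡⟨ trans (∑-S m _) (∑-cong (allLists m) λ s → ∑-S m _) ⟩
    ∑[ s ∈ allLists m ] ∑[ t ∈ allLists m ] isOne (gcd (monic s) (monic t))
      ≡⟨ ∑-cong (allLists m) (λ s → ∑-cong (allLists m) λ t → cong isOne (euclid-step s t)) ⟩
    ∑[ s ∈ allLists m ] ∑[ t ∈ allLists m ] coprimality (monic t) (monic s mod monic t)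
      ≡⟨ ∑-comm (allLists m) (allLists m) (λ s t → coprimality (monic t) (monic s mod monic t)) ⟩
    ∑[ t ∈ allLists m ] ∑[ s ∈ allLists m ] coprimality (monic t) (monic s mod monic t)
      ≡⟨ ∑-allLists-cong m (λ t ∣t∣ → trans
           (∑-allLists-cong m λ s ∣s∣ → cong (coprimality (monic t)) (remainder s t (trans ∣t∣ (sym ∣s∣))))
           (∑-allLists-⊕ m t (λ u → coprimality (monic t) (norm (false ∷ u))) (ℕₚ.≤-reflexive ∣t∣))) ⟩
    coprimeCount m true false
      ≡⟨ coprimeCount≡closedCount m true false ⟩
    2 * geom4 m ∎
    where
    open ≡-Reasoning
    monic : Poly → Poly
    monic s = (true ∷ s) ∷ʳ true
    euclid-step : ∀ s t → gcd (monic s) (monic t) ≡ euclid (monic t) (monic s mod monic t)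
    euclid-step s t = trans (gcd≡euclid (monic s) (monic t) (norm-∷ʳ-true (true ∷ s)) (norm-∷ʳ-true (true ∷ t)))
                            (euclid-monic (monic s) (true ∷ t) (norm-∷ʳ-true (true ∷ s)))
    remainder : ∀ s t → length t ≡ length s → monic s mod monic t ≡ norm (false ∷ (s ⊕ t))
    remainder s t t≡s = begin
      monic s mod monic t
        ≡⟨ mod-monic (true ∷ s) (true ∷ t) (s≤s (ℕₚ.≤-reflexive t≡s)) ⟩
      divStep (true ∷ s) (true ∷ t) mod monic t
        ≡⟨ cong (_mod monic t) (divStep-same-length (true ∷ s) (true ∷ t) (cong suc t≡s)) ⟩
      norm (false ∷ (s ⊕ t)) mod monic t
        ≡⟨ norm-mod-short (true ∷ t) (false ∷ (s ⊕ t)) shorter ⟩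
      norm (false ∷ (s ⊕ t)) ∎
      where
      shorter : length (false ∷ (s ⊕ t)) < length (monic t)
      shorter = subst (length (false ∷ (s ⊕ t)) <_) (sym (length-∷ʳ (true ∷ t) true))
        (s≤s (s≤s (ℕₚ.≤-reflexive (trans (length-⊕ s t (ℕₚ.≤-reflexive t≡s)) (sym t≡s)))))

module ClosedForm where

  open Counting using (geom4)
  open import Data.Nat using (ℕ; zero; suc; _∸_; _<_; s≤s; z≤n)
  import Data.Nat as ℕ
  import Data.Nat.Properties as ℕₚ
  open import Data.Nat.Combinatorics using (_C_; nCk+nC[k+1]≡[n+1]C[k+1]; k>n⇒nCk≡0)
  open import Data.Integer using (ℤ; +_; -_; _+_; _*_; _-_; _^_; _/_)
  import Data.Integer.Properties as ℤₚ
  import Data.Integer.DivMod as ℤ÷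
  import Data.Nat.DivMod as ℕ÷
  open import Data.List using (foldr; map; applyUpTo; upTo)
  open import Function using (_∘_)
  open import Relation.Binary.PropositionalEquality hiding (J)
  open import Algebra.Properties.CommutativeSemigroup ℤₚ.+-commutativeSemigroup using (interchange)
  open import Data.Integer.Tactic.RingSolver using (solve-∀)

  ∑ℤ : ℕ → (ℕ → ℤ) → ℤ
  ∑ℤ zero    f = + 0
  ∑ℤ (suc k) f = f 0 + ∑ℤ k (f ∘ suc)

  foldr-map-applyUpTo : ∀ k (F : ℕ → ℤ) g → foldr _+_ (+ 0) (map F (applyUpTo g k)) ≡ ∑ℤ k (F ∘ g)
  foldr-map-applyUpTo zero    F g = refl
  foldr-map-applyUpTo (suc k) F g = cong (_+_ (F (g 0))) (foldr-map-applyUpTo k F (g ∘ suc))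

  ∑ℤ-suc : ∀ k f → ∑ℤ (suc k) f ≡ ∑ℤ k f + f k
  ∑ℤ-suc zero    f = ℤₚ.+-comm (f 0) (+ 0)
  ∑ℤ-suc (suc k) f = trans (cong (_+_ (f 0)) (∑ℤ-suc k (f ∘ suc))) (sym (ℤₚ.+-assoc (f 0) _ _))

  ∑ℤ-cong : ∀ k {f g} → (∀ i → i < k → f i ≡ g i) → ∑ℤ k f ≡ ∑ℤ k g
  ∑ℤ-cong zero    _   = refl
  ∑ℤ-cong (suc k) f≗g = cong₂ _+_ (f≗g 0 (s≤s z≤n)) (∑ℤ-cong k (λ i i<k → f≗g (suc i) (s≤s i<k)))

  ∑ℤ-distrib-+ : ∀ k f g → ∑ℤ k (λ i → f i + g i) ≡ ∑ℤ k f + ∑ℤ k g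
  ∑ℤ-distrib-+ zero    f g = refl
  ∑ℤ-distrib-+ (suc k) f g =
    trans (cong (_+_ (f 0 + g 0)) (∑ℤ-distrib-+ k (f ∘ suc) (g ∘ suc))) (interchange (f 0) (g 0) _ _)

  ∑ℤ-*ˡ : ∀ k c f → ∑ℤ k (λ i → c * f i) ≡ c * ∑ℤ k f
  ∑ℤ-*ˡ zero    c f = sym (ℤₚ.*-zeroʳ c)
  ∑ℤ-*ˡ (suc k) c f = trans (cong (_+_ (c * f 0)) (∑ℤ-*ˡ k c (f ∘ suc))) (sym (ℤₚ.*-distribˡ-+ c (f 0) _))

  binomialSum : ℕ → (ℕ → ℤ) → ℤ
  binomialSum m u = ∑ℤ (suc m) (λ j → (+ 2) ^ (m ∸ j) * + (m C j) * u j)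

  binomialSum-cong : ∀ m {u v} → (∀ j → u j ≡ v j) → binomialSum m u ≡ binomialSum m v
  binomialSum-cong m u≗v = ∑ℤ-cong (suc m) (λ j _ → cong (_*_ ((+ 2) ^ (m ∸ j) * + (m C j))) (u≗v j))

  binomialSum-*ˡ : ∀ m c u → binomialSum m (λ j → c * u j) ≡ c * binomialSum m u
  binomialSum-*ˡ m c u = trans (∑ℤ-cong (suc m) λ j _ → swap ((+ 2) ^ (m ∸ j) * + (m C j)) c (u j))
                               (∑ℤ-*ˡ (suc m) c (λ j → (+ 2) ^ (m ∸ j) * + (m C j) * u j))
    where
    swap : ∀ w c a → w * (c * a) ≡ c * (w * a)
    swap = solve-∀

  binomialSum-distrib-+ : ∀ m u v → binomialSum m (λ j → u j + v j) ≡ binomialSum m u + binomialSum m v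
  binomialSum-distrib-+ m u v =
    trans (∑ℤ-cong (suc m) λ j _ → ℤₚ.*-distribˡ-+ ((+ 2) ^ (m ∸ j) * + (m C j)) (u j) (v j))
    (∑ℤ-distrib-+ (suc m) (λ j → (+ 2) ^ (m ∸ j) * + (m C j) * u j) (λ j → (+ 2) ^ (m ∸ j) * + (m C j) * v j))

  binomialSum-suc : ∀ m u → binomialSum (suc m) u ≡ + 2 * binomialSum m u + binomialSum m (u ∘ suc)
  binomialSum-suc m u = begin
    head + ∑ℤ (suc m) (λ i → (+ 2) ^ (m ∸ i) * + (suc m C suc i) * u (suc i))
      ≡⟨ cong (_+_ head) (∑ℤ-cong (suc m) λ i _ → pascal i) ⟩
    head + ∑ℤ (suc m) (λ i → P i + R i)
      ≡⟨ cong (_+_ head) (∑ℤ-distrib-+ (suc m) P R) ⟩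
    head + (binomialSum m (u ∘ suc) + ∑ℤ (suc m) R)
      ≡⟨ cong (λ z → head + (binomialSum m (u ∘ suc) + z)) (∑ℤ-suc m R) ⟩
    head + (binomialSum m (u ∘ suc) + (∑ℤ m R + R m))
      ≡⟨ cong₂ (λ z w → head + (binomialSum m (u ∘ suc) + (z + w))) ∑R R-last ⟩
    head + (binomialSum m (u ∘ suc) + (+ 2 * ∑ℤ m (T ∘ suc) + + 0))
      ≡⟨ regroup ((+ 2) ^ m) (u 0) (binomialSum m (u ∘ suc)) (∑ℤ m (T ∘ suc)) ⟩
    + 2 * binomialSum m u + binomialSum m (u ∘ suc) ∎
    where
    open ≡-Reasoning
    head = (+ 2) ^ suc m * + 1 * u 0
    T P R : ℕ → ℤ
    T j = (+ 2) ^ (m ∸ j) * + (m C j) * u j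
    P i = (+ 2) ^ (m ∸ i) * + (m C i) * u (suc i)
    R i = (+ 2) ^ (m ∸ i) * + (m C suc i) * u (suc i)
    distrib : ∀ a b c d → a * (b + c) * d ≡ a * b * d + a * c * d
    distrib = solve-∀
    pascal : ∀ i → (+ 2) ^ (m ∸ i) * + (suc m C suc i) * u (suc i) ≡ P i + R i
    pascal i = trans
      (cong (λ c → (+ 2) ^ (m ∸ i) * c * u (suc i))
        (trans (cong +_ (sym (nCk+nC[k+1]≡[n+1]C[k+1] m i))) (ℤₚ.pos-+ (m C i) (m C suc i))))
      (distrib ((+ 2) ^ (m ∸ i)) (+ (m C i)) (+ (m C suc i)) (u (suc i)))
    R-last : R m ≡ + 0
    R-last rewrite k>n⇒nCk≡0 (ℕₚ.n<1+n m) = vanish ((+ 2) ^ (m ∸ m)) (u (suc m))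
      where
      vanish : ∀ a d → a * + 0 * d ≡ + 0
      vanish = solve-∀
    ∑R : ∑ℤ m R ≡ + 2 * ∑ℤ m (T ∘ suc)
    ∑R = trans (∑ℤ-cong m λ i i<m → trans
                  (cong (λ e → (+ 2) ^ e * + (m C suc i) * u (suc i)) (ℕₚ.+-∸-assoc 1 i<m))
                  (double ((+ 2) ^ (m ∸ suc i)) (+ (m C suc i)) (u (suc i))))
               (∑ℤ-*ˡ m (+ 2) (T ∘ suc))
      where
      double : ∀ a c d → (+ 2 * a) * c * d ≡ + 2 * (a * c * d)
      double = solve-∀
    regroup : ∀ a u₀ b s → (+ 2 * a) * + 1 * u₀ + (b + (+ 2 * s + + 0)) ≡ + 2 * (a * + 1 * u₀ + s) + b
    regroup = solve-∀

  binomialSum-2^ : ∀ m → binomialSum m ((+ 2) ^_) ≡ (+ 4) ^ m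
  binomialSum-2^ zero = refl
  binomialSum-2^ (suc m) = begin
    binomialSum (suc m) ((+ 2) ^_)
      ≡⟨ binomialSum-suc m ((+ 2) ^_) ⟩
    + 2 * binomialSum m ((+ 2) ^_) + binomialSum m (λ j → + 2 * (+ 2) ^ j)
      ≡⟨ cong (_+_ (+ 2 * binomialSum m ((+ 2) ^_))) (binomialSum-*ˡ m (+ 2) ((+ 2) ^_)) ⟩
    + 2 * binomialSum m ((+ 2) ^_) + + 2 * binomialSum m ((+ 2) ^_)
      ≡⟨ cong (λ z → + 2 * z + + 2 * z) (binomialSum-2^ m) ⟩
    + 2 * (+ 4) ^ m + + 2 * (+ 4) ^ m
      ≡⟨ double ((+ 4) ^ m) ⟩
    (+ 4) ^ suc m ∎
    where
    open ≡-Reasoning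
    double : ∀ q → + 2 * q + + 2 * q ≡ + 4 * q
    double = solve-∀

  pos-geom4-suc : ∀ m → + geom4 (suc m) ≡ + 4 * + geom4 m + + 1
  pos-geom4-suc m = trans (ℤₚ.pos-+ (4 ℕ.* geom4 m) 1) (cong (_+ + 1) (ℤₚ.pos-* 4 (geom4 m)))

  3*geom4+1≡4^ : ∀ m → + 3 * + geom4 m + + 1 ≡ (+ 4) ^ m
  3*geom4+1≡4^ zero = refl
  3*geom4+1≡4^ (suc m) = begin
    + 3 * + geom4 (suc m) + + 1       ≡⟨ cong (λ z → + 3 * z + + 1) (pos-geom4-suc m) ⟩
    + 3 * (+ 4 * + geom4 m + + 1) + + 1 ≡⟨ regroup (+ geom4 m) ⟩
    + 4 * (+ 3 * + geom4 m + + 1)     ≡⟨ cong (+ 4 *_) (3*geom4+1≡4^ m) ⟩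
    (+ 4) ^ suc m                     ∎
    where
    open ≡-Reasoning
    regroup : ∀ w → + 3 * (+ 4 * w + + 1) + + 1 ≡ + 4 * (+ 3 * w + + 1)
    regroup = solve-∀

  jacobsthal : ℕ → ℕ
  jacobsthal zero          = 0
  jacobsthal (suc zero)    = 1
  jacobsthal (suc (suc j)) = jacobsthal (suc j) ℕ.+ 2 ℕ.* jacobsthal j

  J : ℕ → ℤ
  J j = + jacobsthal j

  J-rec : ∀ j → J (suc j) + J j ≡ (+ 2) ^ j
  J-rec zero = refl
  J-rec (suc j) = begin
    + (jacobsthal (suc j) ℕ.+ 2 ℕ.* jacobsthal j) + J (suc j)
      ≡⟨ cong (_+ J (suc j)) (trans (ℤₚ.pos-+ (jacobsthal (suc j)) _) (cong (_+_ (J (suc j))) (ℤₚ.pos-* 2 (jacobsthal j)))) ⟩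
    J (suc j) + + 2 * J j + J (suc j)
      ≡⟨ regroup (J (suc j)) (J j) ⟩
    + 2 * (J (suc j) + J j)
      ≡⟨ cong (+ 2 *_) (J-rec j) ⟩
    (+ 2) ^ suc j ∎
    where
    open ≡-Reasoning
    regroup : ∀ a b → a + + 2 * b + a ≡ + 2 * (a + b)
    regroup = solve-∀

  J-closed : ∀ i → + 3 * J (suc i) ≡ (+ 2) ^ suc i + (- + 1) ^ i
  J-closed zero = refl
  J-closed (suc i) = begin
    + 3 * J (suc (suc i))
      ≡⟨ split (J (suc (suc i))) (J (suc i)) ⟩
    + 3 * (J (suc (suc i)) + J (suc i)) - + 3 * J (suc i)
      ≡⟨ cong₂ (λ x y → + 3 * x - y) (J-rec (suc i)) (J-closed i) ⟩
    + 3 * (+ 2) ^ suc i - ((+ 2) ^ suc i + (- + 1) ^ i)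
      ≡⟨ simplify ((+ 2) ^ suc i) ((- + 1) ^ i) ⟩
    (+ 2) ^ suc (suc i) + (- + 1) ^ suc i ∎
    where
    open ≡-Reasoning
    split : ∀ a b → + 3 * a ≡ + 3 * (a + b) - + 3 * b
    split = solve-∀
    simplify : ∀ p s → + 3 * p - (p + s) ≡ + 2 * p + (- + 1) * s
    simplify = solve-∀

  binomialSum-J : ∀ m → binomialSum m J ≡ + geom4 m
  binomialSum-J zero = refl
  binomialSum-J (suc m) = begin
    binomialSum (suc m) J
      ≡⟨ binomialSum-suc m J ⟩
    + 2 * binomialSum m J + binomialSum m (J ∘ suc)
      ≡⟨ cong (_+_ (+ 2 * binomialSum m J)) (binomialSum-cong m J-suc) ⟩
    + 2 * binomialSum m J + binomialSum m (λ j → (+ 2) ^ j + - + 1 * J j)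
      ≡⟨ cong (_+_ (+ 2 * binomialSum m J)) (trans (binomialSum-distrib-+ m ((+ 2) ^_) (λ j → - + 1 * J j))
                                                 (cong₂ _+_ (binomialSum-2^ m) (binomialSum-*ˡ m (- + 1) J))) ⟩
    + 2 * binomialSum m J + ((+ 4) ^ m + - + 1 * binomialSum m J)
      ≡⟨ cong₂ (λ x y → + 2 * x + (y + - + 1 * x)) (binomialSum-J m) (sym (3*geom4+1≡4^ m)) ⟩
    + 2 * + geom4 m + (+ 3 * + geom4 m + + 1 + - + 1 * + geom4 m)
      ≡⟨ regroup (+ geom4 m) ⟩
    + 4 * + geom4 m + + 1
      ≡⟨ pos-geom4-suc m ⟨
    + geom4 (suc m) ∎
    where
    open ≡-Reasoning
    J-suc : ∀ j → J (suc j) ≡ (+ 2) ^ j + - + 1 * J j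
    J-suc j = trans (isolate (J (suc j)) (J j)) (cong (_+ - + 1 * J j) (J-rec j))
      where
      isolate : ∀ a b → a ≡ a + b + - + 1 * b
      isolate = solve-∀
    regroup : ∀ w → + 2 * w + (+ 3 * w + + 1 + - + 1 * w) ≡ + 4 * w + + 1
    regroup = solve-∀

  [3*n]/3≡n : ∀ n → (+ 3 * + n) / + 3 ≡ + n
  [3*n]/3≡n n = begin
    (+ 3 * + n) / + 3   ≡⟨ cong (_/ + 3) (trans (sym (ℤₚ.pos-* 3 n)) (cong +_ (ℕₚ.*-comm 3 n))) ⟩
    + (n ℕ.* 3) / + 3   ≡⟨ ℤ÷.div-pos-is-/ℕ (+ (n ℕ.* 3)) 3 ⟩
    + (n ℕ.* 3 ℕ./ 3)   ≡⟨ cong +_ (ℕ÷.m*n/n≡m n 3) ⟩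
    + n                 ∎
    where open ≡-Reasoning

  J-term : ∀ i → ((+ 2) ^ (2 ℕ.+ i) + + 2 * (- + 1) ^ (2 ℕ.+ i)) / + 3 ≡ + 2 * J (suc i)
  J-term i = begin
    ((+ 2) ^ (2 ℕ.+ i) + + 2 * (- + 1) ^ (2 ℕ.+ i)) / + 3
      ≡⟨ cong (_/ + 3) (factor ((+ 2) ^ suc i) ((- + 1) ^ i)) ⟩
    (+ 2 * ((+ 2) ^ suc i + (- + 1) ^ i)) / + 3
      ≡⟨ cong (λ z → (+ 2 * z) / + 3) (J-closed i) ⟨
    (+ 2 * (+ 3 * J (suc i))) / + 3
      ≡⟨ cong (_/ + 3) (trans (cong (+ 3 *_) (ℤₚ.pos-* 2 (jacobsthal (suc i)))) (swap (J (suc i)))) ⟨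
    (+ 3 * + (2 ℕ.* jacobsthal (suc i))) / + 3
      ≡⟨ [3*n]/3≡n (2 ℕ.* jacobsthal (suc i)) ⟩
    + (2 ℕ.* jacobsthal (suc i))
      ≡⟨ ℤₚ.pos-* 2 (jacobsthal (suc i)) ⟩
    + 2 * J (suc i) ∎
    where
    open ≡-Reasoning
    factor : ∀ p s → + 2 * p + + 2 * (- + 1 * (- + 1 * s)) ≡ + 2 * (p + s)
    factor = solve-∀
    swap : ∀ a → + 3 * (+ 2 * a) ≡ + 2 * (+ 3 * a)
    swap = solve-∀

  -- the summands of the theorem for n = m + 1, after unfolding n ∸ (2 + i) and (n ∸ 1) C (1 + i)
  binomial-form : ∀ m →
    foldr _+_ (+ 0) (map (λ i → (+ 2) ^ (m ∸ suc i) * + (m C suc i)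
                                * (((+ 2) ^ (2 ℕ.+ i) + + 2 * (- + 1) ^ (2 ℕ.+ i)) / + 3))
                         (upTo m))
    ≡ + 2 * + geom4 m
  binomial-form m = begin
    _ ≡⟨ foldr-map-applyUpTo m _ (λ i → i) ⟩
    ∑ℤ m (λ i → (+ 2) ^ (m ∸ suc i) * + (m C suc i) * (((+ 2) ^ (2 ℕ.+ i) + + 2 * (- + 1) ^ (2 ℕ.+ i)) / + 3))
      ≡⟨ ∑ℤ-cong m (λ i _ → trans (cong (_*_ ((+ 2) ^ (m ∸ suc i) * + (m C suc i))) (J-term i))
                                    (swap ((+ 2) ^ (m ∸ suc i) * + (m C suc i)) (J (suc i)))) ⟩
    ∑ℤ m (λ i → + 2 * ((+ 2) ^ (m ∸ suc i) * + (m C suc i) * J (suc i)))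
      ≡⟨ ∑ℤ-*ˡ m (+ 2) _ ⟩
    + 2 * ∑ℤ m (λ i → (+ 2) ^ (m ∸ suc i) * + (m C suc i) * J (suc i))
      ≡⟨ cong (+ 2 *_) (drop-head ((+ 2) ^ m) _) ⟩
    + 2 * binomialSum m J
      ≡⟨ cong (+ 2 *_) (binomialSum-J m) ⟩
    + 2 * + geom4 m ∎
    where
    open ≡-Reasoning
    swap : ∀ w a → w * (+ 2 * a) ≡ + 2 * (w * a)
    swap = solve-∀
    drop-head : ∀ a s → s ≡ a * + 1 * + 0 + s
    drop-head = solve-∀

  power-form : ∀ m → + 2 * (((+ 4) ^ m - + 1) / + 3) ≡ + 2 * + geom4 m
  power-form m = cong (+ 2 *_) (begin
    ((+ 4) ^ m - + 1) / + 3                 ≡⟨ cong (λ z → (z - + 1) / + 3) (3*geom4+1≡4^ m) ⟨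
    (+ 3 * + geom4 m + + 1 - + 1) / + 3     ≡⟨ cong (_/ + 3) (cancel (+ geom4 m)) ⟩
    (+ 3 * + geom4 m) / + 3                 ≡⟨ [3*n]/3≡n (geom4 m) ⟩
    + geom4 m                               ∎)
    where
    open ≡-Reasoning
    cancel : ∀ w → + 3 * w + + 1 - + 1 ≡ + 3 * w
    cancel = solve-∀

open import Defs
open import Data.Nat using (ℕ; _≥_; _∸_)
open import Data.Nat.Combinatorics using (_C_)
open import Data.Integer using (ℤ; +_; -_; _+_; _*_; _-_; _^_; _/_)
open import Data.List using (length; foldr; map; upTo)
open import Data.Product using (_×_; _,_)
open import Relation.Binary.PropositionalEquality using (_≡_; trans; sym; cong)
import Data.Nat as N
open import Data.Integer.Properties using (pos-*)

open Counting using (geom4; length-A)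
open ClosedForm using (binomial-form; power-form)

lemma4 : (n : ℕ) → n ≥ 1 →
    (+ length (A n) ≡ foldr _+_ (+ 0)
        (map (λ i → ((+ 2) ^ (n ∸ (2 N.+ i))) * (+ ((n ∸ 1) C (1 N.+ i)))
                      * ((((+ 2) ^ (2 N.+ i)) + (+ 2) * ((- (+ 1)) ^ (2 N.+ i))) / (+ 3)))
             (upTo (n ∸ 1))))
    × (+ length (A n) ≡ (+ 2) * ((((+ 4) ^ (n ∸ 1)) - (+ 1)) / (+ 3)))
lemma4 N.zero ()
lemma4 (N.suc m) _ = ∣A∣≡ (binomial-form m) , ∣A∣≡ (power-form m)
  where
  ∣A∣≡ : ∀ {x} → x ≡ + 2 * + geom4 m → + length (A (N.suc m)) ≡ x
  ∣A∣≡ x≡ = trans (cong +_ (length-A m)) (trans (pos-* 2 (geom4 m)) (sym x≡))
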